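{- Let $p>2$ be a prime, let $X,Y\subset\mathbb{Z}_p$ with $|Y|>1$, and let $a\in\mathbb{Z}_p^*$. Then $$|2XY-2XY+a*Y^2-a*Y^2|\geq\frac{|X||Y|(p-1)}{|X||Y|+p-1}.$$
   Context: $\mathbb{Z}_p$ is the field of residues modulo $p$, $\mathbb{Z}_p^*=\mathbb{Z}_p\setminus\{0\}$. $XY=\{xy:x\in X,y\in Y\}$, $Y^2=\{y_1y_2:\ y_1,y_2\in Y\}$, $a*S=\{as:\ s\in S\}$, $kS=\{s_1+\dots+s_k:\ s_i\in S\}$, and sums/differences of sets are elementwise ($S+T=\{s+t\}$, $S-T=\{s-t\}$). -}

module Defs where

open import Data.Nat using (ℕ; _+_; _*_; _∸_; NonZero)
open import Data.Nat.DivMod using (_mod_)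
open import Data.Fin using (Fin; toℕ)
open import Data.Fin.Subset using (Subset; _∈_)
open import Data.Product using (∃; ∃-syntax; _×_; _,_)
open import Relation.Binary.PropositionalEquality using (_≡_)

-- Arithmetic of the field ℤ_p, with ℤ_p represented as Fin p
-- (residues 0, …, p-1).
module _ {p : ℕ} .{{_ : NonZero p}} where

  infixl 6 _+ₚ_ _-ₚ_
  infixl 7 _*ₚ_

  _+ₚ_ : Fin p → Fin p → Fin p
  x +ₚ y = (toℕ x + toℕ y) mod p

  _*ₚ_ : Fin p → Fin p → Fin p
  x *ₚ y = (toℕ x * toℕ y) mod p

  -ₚ_ : Fin p → Fin p
  -ₚ x = (p ∸ toℕ x) mod p

  _-ₚ_ : Fin p → Fin p → Fin p
  x -ₚ y = x +ₚ (-ₚ y)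

  ZSet : Set₁
  ZSet = Fin p → Set

  ⟦_⟧ : Subset p → ZSet
  ⟦ X ⟧ z = z ∈ X

  _⊕_ : ZSet → ZSet → ZSet
  (S ⊕ T) z = ∃[ s ] ∃[ t ] (S s × T t × z ≡ s +ₚ t)

  _⊖_ : ZSet → ZSet → ZSet
  (S ⊖ T) z = ∃[ s ] ∃[ t ] (S s × T t × z ≡ s -ₚ t)

  _⊗_ : ZSet → ZSet → ZSet
  (S ⊗ T) z = ∃[ s ] ∃[ t ] (S s × T t × z ≡ s *ₚ t)

  sq : ZSet → ZSet
  sq S = S ⊗ S

  _⊛_ : Fin p → ZSet → ZSet
  (a ⊛ S) z = ∃[ s ] (S s × z ≡ a *ₚ s)

  twice : ZSet → ZSet
  twice S = S ⊕ S

  infixl 6 _⊕_ _⊖_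
  infixl 7 _⊗_ _⊛_

  bigSet : Subset p → Subset p → Fin p → ZSet
  bigSet X Y a =
    ((twice (⟦ X ⟧ ⊗ ⟦ Y ⟧) ⊖ twice (⟦ X ⟧ ⊗ ⟦ Y ⟧)) ⊕ (a ⊛ sq ⟦ Y ⟧)) ⊖ (a ⊛ sq ⟦ Y ⟧)

{-# OPTIONS --safe #-}
-- Call ξ a difference ratio of (X, Y) if x₁ - x₂ = ξ (y₁ - y₂) for some x₁, x₂ ∈ X and
-- distinct y₁, y₂ ∈ Y.  For such ξ, (x , y) ∈ X × Y and w ∈ Y, the elements
--   x y₁ + x₁ y - (x y₂ + x₂ y) + a w y₁ - a w y₂ = (y₁ - y₂) (x + ξ y + a w)
-- lie in 2XY - 2XY + a*Y² - a*Y².  Taking w = y₁ and w = y gives dilated translates of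
-- X + ξ Y and X + (ξ + a) Y inside S.  Whenever S contains such a copy of X + λ Y,
-- Cauchy–Schwarz on the fibres gives N² ≤ |S| (N + C λ), where N = |X| |Y| and C λ counts
-- the ordered pairs of points of X × Y with different y on a common line x + λ y = const.
-- Walk along 0, a, 2a, …, (p-1)a, starting from the ratio 0.  Either some ξ = k a is a
-- ratio but ξ + a is not, so C (ξ + a) = 0 and |S| ≥ N; or a, 2a, …, (p-1)a are all
-- ratios.  These are distinct and two points with different y lie on one line only, so
-- the C values sum to at most N², and adding the p - 1 inequalities gives
-- (p-1) N² ≤ |S| ((p-1) N + N²).
module Submission where

module Counting where

  open import Data.Bool.Base using (true; false; if_then_else_)
  open import Data.Fin.Base using (Fin; zero; suc)
  open import Data.Fin.Properties using (_≟_; suc-injective; 0≢1+n)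
  open import Data.Fin.Subset using (Subset; _∈_; ∣_∣)
  open import Data.Fin.Subset.Properties using (_∈?_)
  open import Data.Nat.Base using (ℕ; zero; suc; _+_; _*_; _≤_; z≤n; s≤s)
  open import Data.Nat.Properties hiding (_≟_; suc-injective; 0≢1+n)
  open import Algebra.Properties.Semiring.Sum +-*-semiring
    using (sum; sum-cong-≗; sum-replicate-zero; ∑-comm; ∑-distrib-+; *-distribˡ-sum; *-distribʳ-sum)
  open import Data.Nat.Tactic.RingSolver using (solve-∀)
  open import Data.Product.Base using (_×_; _,_; uncurry)
  open import Data.Product.Properties using (,-injective)
  open import Data.Sum.Base using (_⊎_; inj₁; inj₂)
  open import Data.Vec.Base using ([]; _∷_)
  open import Relation.Binary.Core using (Rel)
  open import Relation.Binary.Definitions using (Decidable; DecidableEquality)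
  open import Relation.Binary.PropositionalEquality
  open import Relation.Nullary.Decidable.Core using (Dec; does; yes; no; _×-dec_; map′)
  open import Relation.Nullary.Negation.Core using (¬_; contradiction)

  𝟙 : ∀ {a} {A : Set a} → Dec A → ℕ
  𝟙 d = if does d then 1 else 0

  module _ {a} {A : Set a} where

    𝟙≤1 : (d : Dec A) → 𝟙 d ≤ 1
    𝟙≤1 (yes _) = s≤s z≤n
    𝟙≤1 (no _)  = z≤n

    𝟙-yes : (d : Dec A) → A → 𝟙 d ≡ 1
    𝟙-yes (yes _) _ = refl
    𝟙-yes (no ¬a) a = contradiction a ¬a

    𝟙-no : (d : Dec A) → ¬ A → 𝟙 d ≡ 0
    𝟙-no (yes a) ¬a = contradiction a ¬a
    𝟙-no (no _)  _  = refl

  𝟙-×-dec : ∀ {a b} {A : Set a} {B : Set b} (d : Dec A) (e : Dec B) → 𝟙 (d ×-dec e) ≡ 𝟙 d * 𝟙 e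
  𝟙-×-dec (yes _) e = sym (+-identityʳ (𝟙 e))
  𝟙-×-dec (no _)  e = refl

  ∣S∣≡sum𝟙∈ : ∀ {n} (S : Subset n) → ∣ S ∣ ≡ sum λ i → 𝟙 (i ∈? S)
  ∣S∣≡sum𝟙∈ []          = refl
  ∣S∣≡sum𝟙∈ (true  ∷ S) = cong suc (∣S∣≡sum𝟙∈ S)
  ∣S∣≡sum𝟙∈ (false ∷ S) = ∣S∣≡sum𝟙∈ S

  sum-const : ∀ n c → sum {n} (λ _ → c) ≡ n * c
  sum-const zero    c = refl
  sum-const (suc n) c = cong (c +_) (sum-const n c)

  sum-mono-≤ : ∀ {n} {f g : Fin n → ℕ} → (∀ i → f i ≤ g i) → sum f ≤ sum g
  sum-mono-≤ {zero}  f≤g = z≤n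
  sum-mono-≤ {suc n} f≤g = +-mono-≤ (f≤g zero) (sum-mono-≤ (λ i → f≤g (suc i)))

  sum-*-sum : ∀ {m n} (f : Fin m → ℕ) (g : Fin n → ℕ) → sum f * sum g ≡ sum λ i → sum λ j → f i * g j
  sum-*-sum f g = trans (*-distribʳ-sum (sum g) f) (sum-cong-≗ λ i → *-distribˡ-sum (f i) g)

  sum-𝟙≟ : ∀ {n} (i : Fin n) (g : Fin n → ℕ) → sum (λ j → 𝟙 (i ≟ j) * g j) ≡ g i
  sum-𝟙≟ {suc n} zero    g =
    trans (cong₂ _+_ (+-identityʳ (g zero)) (sum-replicate-zero n)) (+-identityʳ (g zero))
  sum-𝟙≟ {suc n} (suc i) g = sum-𝟙≟ i (λ j → g (suc j))

  sum-𝟙-disjoint : ∀ {k p} {P : Fin k → Set p} (P? : ∀ i → Dec (P i)) →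
                   (∀ {i j} → P i → P j → i ≡ j) → sum (λ i → 𝟙 (P? i)) ≤ 1
  sum-𝟙-disjoint {zero}  P? disjoint = z≤n
  sum-𝟙-disjoint {suc k} P? disjoint with P? zero
  ... | no _   = sum-𝟙-disjoint (λ i → P? (suc i)) λ Pi Pj → suc-injective (disjoint Pi Pj)
  ... | yes P0 = ≤-reflexive (cong suc (trans (sum-cong-≗ rest≡0) (sum-replicate-zero k)))
    where
    rest≡0 : ∀ i → 𝟙 (P? (suc i)) ≡ 0
    rest≡0 i = 𝟙-no (P? (suc i)) λ Pi → 0≢1+n (disjoint P0 Pi)

  2xy≤x²+y² : ∀ x y → 2 * (x * y) ≤ x * x + y * y
  2xy≤x²+y² x y with ≤-total x y
  ... | inj₁ x≤y with c , refl ← m≤n⇒∃[o]m+o≡n x≤y =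
    subst (2 * (x * (x + c)) ≤_) (lemma x c) (m≤m+n _ (c * c))
    where lemma : ∀ x c → 2 * (x * (x + c)) + c * c ≡ x * x + (x + c) * (x + c)
          lemma = solve-∀
  ... | inj₂ y≤x with c , refl ← m≤n⇒∃[o]m+o≡n y≤x =
    subst (2 * ((y + c) * y) ≤_) (lemma y c) (m≤m+n _ (c * c))
    where lemma : ∀ y c → 2 * ((y + c) * y) + c * c ≡ (y + c) * (y + c) + y * y
          lemma = solve-∀

  cauchy-schwarz : ∀ {n} (w r : Fin n → ℕ) →
    sum (λ i → w i * r i) * sum (λ i → w i * r i) ≤ sum w * sum (λ i → w i * (r i * r i))
  cauchy-schwarz {n} w r = *-cancelˡ-≤ 2 (begin
    2 * (sum wr * sum wr)                               ≡⟨ cong (2 *_) (sum-*-sum wr wr) ⟩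
    2 * sum (λ i → sum λ j → wr i * wr j)               ≡⟨ *-distribˡ-sum 2 (λ i → sum λ j → wr i * wr j) ⟩
    sum (λ i → 2 * sum λ j → wr i * wr j)               ≡⟨ sum-cong-≗ (λ i → *-distribˡ-sum 2 (λ j → wr i * wr j)) ⟩
    sum (λ i → sum λ j → 2 * (wr i * wr j))             ≤⟨ sum-mono-≤ (λ i → sum-mono-≤ (pointwise i)) ⟩
    sum (λ i → sum λ j → v i j + v j i)                 ≡⟨ sum-cong-≗ (λ i → ∑-distrib-+ (v i) (λ j → v j i)) ⟩
    sum (λ i → sum (v i) + sum λ j → v j i)             ≡⟨ ∑-distrib-+ (λ i → sum (v i)) (λ i → sum λ j → v j i) ⟩
    V + sum (λ i → sum λ j → v j i)                     ≡⟨ cong (V +_) (∑-comm (λ i j → v j i)) ⟩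
    V + V                                               ≡⟨ cong (V +_) (+-identityʳ V) ⟨
    2 * V                                               ≡⟨ cong (2 *_) (sum-*-sum w λ j → w j * (r j * r j)) ⟨
    2 * (sum w * sum λ i → w i * (r i * r i))           ∎)
    where
    open ≤-Reasoning
    wr : Fin n → ℕ
    wr i = w i * r i
    v : Fin n → Fin n → ℕ
    v i j = w i * (w j * (r j * r j))
    V : ℕ
    V = sum λ i → sum λ j → v i j
    pointwise : ∀ i j → 2 * (wr i * wr j) ≤ v i j + v j i
    pointwise i j = subst₂ _≤_ (lemma₁ (w i) (w j) (r i) (r j)) (lemma₂ (w i) (w j) (r i) (r j))
                           (*-monoʳ-≤ (w i * w j) (2xy≤x²+y² (r i) (r j)))
      where
      lemma₁ : ∀ a b x y → a * b * (2 * (x * y)) ≡ 2 * ((a * x) * (b * y))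
      lemma₁ = solve-∀
      lemma₂ : ∀ a b x y → a * b * (x * x + y * y) ≡ a * (b * (y * y)) + b * (a * (x * x))
      lemma₂ = solve-∀

  module _ {n : ℕ} where

    ∑₂ : (Fin n × Fin n → ℕ) → ℕ
    ∑₂ F = sum λ x → sum λ y → F (x , y)

    ∑₂-cong : ∀ {F G : Fin n × Fin n → ℕ} → (∀ u → F u ≡ G u) → ∑₂ F ≡ ∑₂ G
    ∑₂-cong F≗G = sum-cong-≗ λ x → sum-cong-≗ λ y → F≗G (x , y)

    ∑₂-mono-≤ : ∀ {F G : Fin n × Fin n → ℕ} → (∀ u → F u ≤ G u) → ∑₂ F ≤ ∑₂ G
    ∑₂-mono-≤ F≤G = sum-mono-≤ λ x → sum-mono-≤ λ y → F≤G (x , y)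

    ∑₂-zero : ∑₂ (λ _ → 0) ≡ 0
    ∑₂-zero = trans (sum-cong-≗ {n} (λ _ → sum-replicate-zero n)) (sum-replicate-zero n)

    ∑₂-distrib-+ : ∀ (F G : Fin n × Fin n → ℕ) → ∑₂ (λ u → F u + G u) ≡ ∑₂ F + ∑₂ G
    ∑₂-distrib-+ F G = trans (sum-cong-≗ λ x → ∑-distrib-+ (λ y → F (x , y)) (λ y → G (x , y)))
                             (∑-distrib-+ (λ x → sum λ y → F (x , y)) (λ x → sum λ y → G (x , y)))

    *-distribˡ-∑₂ : ∀ c (F : Fin n × Fin n → ℕ) → c * ∑₂ F ≡ ∑₂ λ u → c * F u
    *-distribˡ-∑₂ c F = trans (*-distribˡ-sum c (λ x → sum λ y → F (x , y)))
                              (sum-cong-≗ λ x → *-distribˡ-sum c (λ y → F (x , y)))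

    *-distribʳ-∑₂ : ∀ c (F : Fin n × Fin n → ℕ) → ∑₂ F * c ≡ ∑₂ λ u → F u * c
    *-distribʳ-∑₂ c F = trans (*-distribʳ-sum c (λ x → sum λ y → F (x , y)))
                              (sum-cong-≗ λ x → *-distribʳ-sum c (λ y → F (x , y)))

    ∑₂-*-∑₂ : ∀ (F G : Fin n × Fin n → ℕ) → ∑₂ F * ∑₂ G ≡ ∑₂ λ u → ∑₂ λ v → F u * G v
    ∑₂-*-∑₂ F G = trans (*-distribʳ-∑₂ (∑₂ G) F) (∑₂-cong λ u → *-distribˡ-∑₂ (F u) G)

    sum-∑₂-comm : ∀ {k} (F : Fin k → Fin n × Fin n → ℕ) →
                  sum (λ i → ∑₂ (F i)) ≡ ∑₂ λ u → sum λ i → F i u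
    sum-∑₂-comm F = trans (∑-comm λ i x → sum λ y → F i (x , y))
                          (sum-cong-≗ λ x → ∑-comm λ i y → F i (x , y))

    infix 4 _≟₂_
    _≟₂_ : DecidableEquality (Fin n × Fin n)
    (x , y) ≟₂ (x′ , y′) = map′ (uncurry (cong₂ _,_)) ,-injective (x ≟ x′ ×-dec y ≟ y′)

    ∑₂-𝟙≟₂ : ∀ u (g : Fin n × Fin n → ℕ) → ∑₂ (λ v → 𝟙 (u ≟₂ v) * g v) ≡ g u
    ∑₂-𝟙≟₂ (x , y) g = begin
      ∑₂ (λ (x′ , y′) → 𝟙 (x ≟ x′ ×-dec y ≟ y′) * g (x′ , y′))
        ≡⟨ ∑₂-cong (λ (x′ , y′) → split (x ≟ x′) (y ≟ y′) (g (x′ , y′))) ⟩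
      sum (λ x′ → sum λ y′ → δx x′ * (δy y′ * g (x′ , y′)))
        ≡⟨ sum-cong-≗ (λ x′ → *-distribˡ-sum (δx x′) (λ y′ → δy y′ * g (x′ , y′))) ⟨
      sum (λ x′ → δx x′ * sum λ y′ → δy y′ * g (x′ , y′))
        ≡⟨ sum-cong-≗ (λ x′ → cong (δx x′ *_) (sum-𝟙≟ y (λ y′ → g (x′ , y′)))) ⟩
      sum (λ x′ → δx x′ * g (x′ , y))
        ≡⟨ sum-𝟙≟ x (λ x′ → g (x′ , y)) ⟩
      g (x , y) ∎
      where
      open ≡-Reasoning
      δx δy : Fin n → ℕ
      δx x′ = 𝟙 (x ≟ x′)
      δy y′ = 𝟙 (y ≟ y′)
      split : ∀ {a b} {A : Set a} {B : Set b} (d : Dec A) (e : Dec B) c →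
              𝟙 (d ×-dec e) * c ≡ 𝟙 d * (𝟙 e * c)
      split d e c = trans (cong (_* c) (𝟙-×-dec d e)) (*-assoc (𝟙 d) (𝟙 e) c)

  module PairCounting {n ℓ} {A : Fin n × Fin n → Set ℓ} (A? : ∀ u → Dec (A u)) where

    size : ℕ
    size = ∑₂ λ u → 𝟙 (A? u)

    pairCount : ∀ {r} {R : Rel (Fin n × Fin n) r} → Decidable R → ℕ
    pairCount R? = ∑₂ λ u → ∑₂ λ v → 𝟙 (A? u) * (𝟙 (R? u v) * 𝟙 (A? v))

    pairCount≡0 : ∀ {r} {R : Rel (Fin n × Fin n) r} (R? : Decidable R) →
                  (∀ {u v} → A u → A v → ¬ R u v) → pairCount R? ≡ 0
    pairCount≡0 R? none = trans (∑₂-cong λ u → trans (∑₂-cong (pointwise u)) (∑₂-zero {n})) (∑₂-zero {n})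
      where
      pointwise : ∀ u v → 𝟙 (A? u) * (𝟙 (R? u v) * 𝟙 (A? v)) ≡ 0
      pointwise u v with A? u | R? u v | A? v
      ... | no _  | _     | _     = refl
      ... | yes _ | no _  | _     = refl
      ... | yes _ | yes _ | no _  = refl
      ... | yes a | yes r | yes b = contradiction r (none a b)

    sum-pairCount≤size² : ∀ {k r} {R : Fin k → Rel (Fin n × Fin n) r} (R? : ∀ i → Decidable (R i)) →
                          (∀ {i j u v} → R i u v → R j u v → i ≡ j) →
                          sum (λ i → pairCount (R? i)) ≤ size * size
    sum-pairCount≤size² {k} R? unique = begin
      sum (λ i → pairCount (R? i))                        ≡⟨ sum-∑₂-comm (λ i u → ∑₂ λ v → term i u v) ⟩
      ∑₂ (λ u → sum λ i → ∑₂ λ v → term i u v)            ≡⟨ ∑₂-cong (λ u → sum-∑₂-comm λ i v → term i u v) ⟩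
      ∑₂ (λ u → ∑₂ λ v → sum λ i → term i u v)            ≡⟨ ∑₂-cong (λ u → ∑₂-cong λ v → factor u v) ⟩
      ∑₂ (λ u → ∑₂ λ v → 𝟙 (A? u) * (#R u v * 𝟙 (A? v)))  ≤⟨ ∑₂-mono-≤ (λ u → ∑₂-mono-≤ λ v → #R≤1 u v) ⟩
      ∑₂ (λ u → ∑₂ λ v → 𝟙 (A? u) * 𝟙 (A? v))             ≡⟨ ∑₂-*-∑₂ (λ u → 𝟙 (A? u)) (λ v → 𝟙 (A? v)) ⟨
      size * size                                         ∎
      where
      open ≤-Reasoning
      term : Fin k → Fin n × Fin n → Fin n × Fin n → ℕ
      term i u v = 𝟙 (A? u) * (𝟙 (R? i u v) * 𝟙 (A? v))
      #R : Fin n × Fin n → Fin n × Fin n → ℕ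
      #R u v = sum λ i → 𝟙 (R? i u v)
      factor : ∀ u v → sum (λ i → term i u v) ≡ 𝟙 (A? u) * (#R u v * 𝟙 (A? v))
      factor u v = sym (trans (cong (𝟙 (A? u) *_) (*-distribʳ-sum (𝟙 (A? v)) λ i → 𝟙 (R? i u v)))
                              (*-distribˡ-sum (𝟙 (A? u)) λ i → 𝟙 (R? i u v) * 𝟙 (A? v)))
      #R≤1 : ∀ u v → 𝟙 (A? u) * (#R u v * 𝟙 (A? v)) ≤ 𝟙 (A? u) * 𝟙 (A? v)
      #R≤1 u v = *-monoʳ-≤ (𝟙 (A? u)) (≤-trans (*-monoˡ-≤ (𝟙 (A? v)) (sum-𝟙-disjoint (λ i → R? i u v) unique))
                                               (≤-reflexive (*-identityˡ (𝟙 (A? v)))))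

    module _ (f : Fin n × Fin n → Fin n) where

      fibre : Fin n → ℕ
      fibre z = ∑₂ λ u → 𝟙 (f u ≟ z) * 𝟙 (A? u)

      energy : ℕ
      energy = ∑₂ λ u → ∑₂ λ v → 𝟙 (A? u) * (𝟙 (f v ≟ f u) * 𝟙 (A? v))

      sum-fibre : sum fibre ≡ size
      sum-fibre = trans (sum-∑₂-comm λ z u → 𝟙 (f u ≟ z) * 𝟙 (A? u))
                        (∑₂-cong λ u → sum-𝟙≟ (f u) (λ _ → 𝟙 (A? u)))

      sum-fibre² : sum (λ z → fibre z * fibre z) ≡ energy
      sum-fibre² = begin
        sum (λ z → fibre z * fibre z)
          ≡⟨ sum-cong-≗ (λ z → ∑₂-*-∑₂ (term z) (term z)) ⟩
        sum (λ z → ∑₂ λ u → ∑₂ λ v → term z u * term z v)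
          ≡⟨ sum-∑₂-comm (λ z u → ∑₂ λ v → term z u * term z v) ⟩
        ∑₂ (λ u → sum λ z → ∑₂ λ v → term z u * term z v)
          ≡⟨ ∑₂-cong (λ u → sum-∑₂-comm λ z v → term z u * term z v) ⟩
        ∑₂ (λ u → ∑₂ λ v → sum λ z → term z u * term z v)
          ≡⟨ ∑₂-cong (λ u → ∑₂-cong λ v → sum-cong-≗ λ z →
               reassoc (𝟙 (f u ≟ z)) (𝟙 (A? u)) (𝟙 (f v ≟ z)) (𝟙 (A? v))) ⟩
        ∑₂ (λ u → ∑₂ λ v → sum λ z → 𝟙 (f u ≟ z) * (𝟙 (A? u) * (𝟙 (f v ≟ z) * 𝟙 (A? v))))
          ≡⟨ ∑₂-cong (λ u → ∑₂-cong λ v → sum-𝟙≟ (f u) λ z → 𝟙 (A? u) * (𝟙 (f v ≟ z) * 𝟙 (A? v))) ⟩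
        energy ∎
        where
        open ≡-Reasoning
        term : Fin n → Fin n × Fin n → ℕ
        term z u = 𝟙 (f u ≟ z) * 𝟙 (A? u)
        reassoc : ∀ a b c d → (a * b) * (c * d) ≡ a * (b * (c * d))
        reassoc = solve-∀

      fibre≤𝟙∈*fibre : ∀ (S : Subset n) → (∀ {u} → A u → f u ∈ S) →
                       ∀ z → fibre z ≤ 𝟙 (z ∈? S) * fibre z
      fibre≤𝟙∈*fibre S f∈S z =
        ≤-trans (∑₂-mono-≤ pointwise) (≤-reflexive (sym (*-distribˡ-∑₂ (𝟙 (z ∈? S)) λ u → 𝟙 (f u ≟ z) * 𝟙 (A? u))))
        where
        pointwise : ∀ u → 𝟙 (f u ≟ z) * 𝟙 (A? u) ≤ 𝟙 (z ∈? S) * (𝟙 (f u ≟ z) * 𝟙 (A? u))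
        pointwise u with f u ≟ z | A? u
        ... | yes refl | yes a = ≤-reflexive (sym (cong (_* 1) (𝟙-yes (f u ∈? S) (f∈S a))))
        ... | yes _    | no _  = z≤n
        ... | no _     | _     = z≤n

      size²≤∣S∣*energy : ∀ (S : Subset n) → (∀ {u} → A u → f u ∈ S) → size * size ≤ ∣ S ∣ * energy
      size²≤∣S∣*energy S f∈S = begin
        size * size                                            ≡⟨ cong₂ _*_ sum-fibre sum-fibre ⟨
        sum fibre * sum fibre                                  ≤⟨ *-mono-≤ (sum-mono-≤ supported) (sum-mono-≤ supported) ⟩
        sum (λ z → χ z * fibre z) * sum (λ z → χ z * fibre z)  ≤⟨ cauchy-schwarz χ fibre ⟩
        sum χ * sum (λ z → χ z * (fibre z * fibre z))          ≤⟨ *-monoʳ-≤ (sum χ) (sum-mono-≤ χ*≤) ⟩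
        sum χ * sum (λ z → 1 * (fibre z * fibre z))            ≡⟨ cong₂ _*_ (∣S∣≡sum𝟙∈ S) (sum-cong-≗ 1*≡) ⟨
        ∣ S ∣ * sum (λ z → fibre z * fibre z)                  ≡⟨ cong (∣ S ∣ *_) sum-fibre² ⟩
        ∣ S ∣ * energy                                         ∎
        where
        open ≤-Reasoning
        χ : Fin n → ℕ
        χ z = 𝟙 (z ∈? S)
        supported : ∀ z → fibre z ≤ χ z * fibre z
        supported = fibre≤𝟙∈*fibre S f∈S
        χ*≤ : ∀ z → χ z * (fibre z * fibre z) ≤ 1 * (fibre z * fibre z)
        χ*≤ z = *-monoˡ-≤ (fibre z * fibre z) (𝟙≤1 (z ∈? S))
        1*≡ : ∀ z → fibre z * fibre z ≡ 1 * (fibre z * fibre z)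
        1*≡ z = sym (*-identityˡ (fibre z * fibre z))

      energy≤size+pairCount : ∀ {r} {R : Rel (Fin n × Fin n) r} (R? : Decidable R) →
                              (∀ {u v} → A u → A v → f v ≡ f u → u ≡ v ⊎ R u v) →
                              energy ≤ size + pairCount R?
      energy≤size+pairCount R? collision = begin
        energy
          ≤⟨ ∑₂-mono-≤ (λ u → ∑₂-mono-≤ (pointwise u)) ⟩
        ∑₂ (λ u → ∑₂ λ v → diagonal u v + pairTerm u v)
          ≡⟨ ∑₂-cong (λ u → ∑₂-distrib-+ (diagonal u) (pairTerm u)) ⟩
        ∑₂ (λ u → ∑₂ (diagonal u) + ∑₂ (pairTerm u))
          ≡⟨ ∑₂-cong (λ u → cong (_+ ∑₂ (pairTerm u)) (∑₂-𝟙≟₂ u λ _ → 𝟙 (A? u))) ⟩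
        ∑₂ (λ u → 𝟙 (A? u) + ∑₂ (pairTerm u))
          ≡⟨ ∑₂-distrib-+ (λ u → 𝟙 (A? u)) (λ u → ∑₂ (pairTerm u)) ⟩
        size + pairCount R? ∎
        where
        open ≤-Reasoning
        diagonal pairTerm : Fin n × Fin n → Fin n × Fin n → ℕ
        diagonal u v = 𝟙 (u ≟₂ v) * 𝟙 (A? u)
        pairTerm u v = 𝟙 (A? u) * (𝟙 (R? u v) * 𝟙 (A? v))
        pointwise : ∀ u v → 𝟙 (A? u) * (𝟙 (f v ≟ f u) * 𝟙 (A? v)) ≤ diagonal u v + pairTerm u v
        pointwise u v with A? u | f v ≟ f u | A? v
        ... | no _  | _     | _     = z≤n
        ... | yes _ | no _  | _     = z≤n
        ... | yes _ | yes _ | no _  = z≤n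
        ... | yes a | yes e | yes b with collision a b e
        ...   | inj₁ refl = ≤-trans (≤-reflexive (sym (cong (_* 1) (𝟙-yes (u ≟₂ u) refl)))) (m≤m+n _ _)
        ...   | inj₂ r    = ≤-trans (≤-reflexive (sym (cong (λ t → 1 * (t * 1)) (𝟙-yes (R? u v) r))))
                                    (m≤n+m _ (𝟙 (u ≟₂ v) * 1))

module Residues where

  open import Defs using (_+ₚ_; _*ₚ_; -ₚ_; _-ₚ_)
  open import Data.Fin.Base using (Fin; toℕ)
  open import Data.Fin.Properties using (toℕ-fromℕ<; toℕ<n; toℕ-injective)
  open import Data.Integer.Base using (ℤ; +_; _+_; _-_; -_; _*_; ∣_∣; _⊖_)
  open import Data.Integer.DivMod using (a≡a%ℕn+[a/ℕn]*n)
  open import Data.Integer.Divisibility.Signed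
    using (_∣_; divides; ∣ᵤ⇒∣; ∣⇒∣ᵤ; ∣-refl; ∣m∣n⇒∣m+n; ∣m⇒∣-m; ∣n⇒∣m*n)
  open import Data.Integer.Properties
    using (pos-+; pos-*; abs-*; m-n≡m⊖n; ⊖-≥; ∣⊖∣-≤; ∣m⊖n∣≡∣n⊖m∣; ∣i∣≡0⇒i≡0; i-j≡0⇒i≡j; +-injective)
  open import Data.Integer.Tactic.RingSolver using (solve-∀)
  open import Data.Nat.Base as ℕ using (ℕ; zero; suc; NonZero)
  open import Data.Nat.DivMod using (_mod_; _%_; _/_)
  open import Data.Nat.Divisibility as ℕ using (>⇒∤)
  open import Data.Nat.Primality using (Prime; euclidsLemma)
  import Data.Nat.Properties as ℕ
  open import Data.Sum.Base using (inj₁; inj₂)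
  open import Function.Base using (_∘_)
  open import Relation.Binary.PropositionalEquality
  open import Relation.Nullary.Negation.Core using (¬_; contradiction)

  ∣∧<⇒≡0 : ∀ {p d} → p ℕ.∣ d → d ℕ.< p → d ≡ 0
  ∣∧<⇒≡0 {d = zero}  _   _   = refl
  ∣∧<⇒≡0 {d = suc _} p∣d d<p = contradiction p∣d (>⇒∤ d<p)

  ∣a⊖b∣<p : ∀ {p a b} → a ℕ.< p → b ℕ.< p → ∣ a ⊖ b ∣ ℕ.< p
  ∣a⊖b∣<p {p} {a} {b} a<p b<p with ℕ.≤-total a b
  ... | inj₁ a≤b = subst (ℕ._< p) (sym (∣⊖∣-≤ a≤b)) (ℕ.≤-<-trans (ℕ.m∸n≤m b a) b<p)
  ... | inj₂ b≤a = subst (ℕ._< p) (trans (sym (∣⊖∣-≤ b≤a)) (∣m⊖n∣≡∣n⊖m∣ b a))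
                                 (ℕ.≤-<-trans (ℕ.m∸n≤m a b) a<p)

  p∣a-b⇒a≡b : ∀ {p a b} → a ℕ.< p → b ℕ.< p → + p ∣ + a - + b → a ≡ b
  p∣a-b⇒a≡b {p} {a} {b} a<p b<p p∣a-b = +-injective (i-j≡0⇒i≡j (+ a) (+ b) (∣i∣≡0⇒i≡0 ∣a-b∣≡0))
    where
    ∣a-b∣≡0 : ∣ + a - + b ∣ ≡ 0
    ∣a-b∣≡0 = ∣∧<⇒≡0 (∣⇒∣ᵤ p∣a-b) (subst (ℕ._< p) (cong ∣_∣ (sym (m-n≡m⊖n a b))) (∣a⊖b∣<p a<p b<p))

  prime-∣*⇒∣ : ∀ {p} → Prime p → ∀ {i j} → ¬ (+ p ∣ i) → + p ∣ i * j → + p ∣ j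
  prime-∣*⇒∣ p-prime {i} {j} p∤i p∣ij
    with euclidsLemma ∣ i ∣ ∣ j ∣ p-prime (subst (_ ℕ.∣_) (abs-* i j) (∣⇒∣ᵤ p∣ij))
  ... | inj₁ p∣i = contradiction (∣ᵤ⇒∣ p∣i) p∤i
  ... | inj₂ p∣j = ∣ᵤ⇒∣ p∣j

  module _ {p : ℕ} .{{_ : NonZero p}} where

    toℤ : Fin p → ℤ
    toℤ u = + toℕ u

    -- Identities in ℤₚ are proved by lifting them to ℤ, where the ring solver applies.
    -- The record (rather than a bare divisibility) keeps u and U inferable.
    infix 4 _≅_
    record _≅_ (u : Fin p) (U : ℤ) : Set where
      constructor mk≅
      field divides-difference : + p ∣ toℤ u - U

    p∣0 : + p ∣ + 0
    p∣0 = divides (+ 0) refl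

    ∣-sum : ∀ {i j k} → + p ∣ i → + p ∣ j → i + j ≡ k → + p ∣ k
    ∣-sum p∣i p∣j refl = ∣m∣n⇒∣m+n p∣i p∣j

    toℤ-≅ : ∀ u → u ≅ toℤ u
    toℤ-≅ u = mk≅ (subst (+ p ∣_) (lemma (toℤ u)) p∣0)
      where lemma : ∀ x → + 0 ≡ x - x
            lemma = solve-∀

    ≅-trans-∣ : ∀ {u U V} → u ≅ U → + p ∣ U - V → u ≅ V
    ≅-trans-∣ {u} {U} {V} (mk≅ d) e = mk≅ (∣-sum d e (lemma (toℤ u) U V))
      where lemma : ∀ x y z → (x - y) + (y - z) ≡ x - z
            lemma = solve-∀

    ≅-≡⇒∣ : ∀ {u v U V} → u ≅ U → v ≅ V → u ≡ v → + p ∣ U - V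
    ≅-≡⇒∣ {u} {_} {U} {V} (mk≅ d) (mk≅ e) refl = ∣-sum (∣m⇒∣-m d) e (lemma (toℤ u) U V)
      where lemma : ∀ x y z → - (x - y) + (x - z) ≡ y - z
            lemma = solve-∀

    ∣⇒≅-≡ : ∀ {u v U V} → u ≅ U → v ≅ V → + p ∣ U - V → u ≡ v
    ∣⇒≅-≡ {u} {v} {U} {V} (mk≅ d) (mk≅ e) f =
      toℕ-injective (p∣a-b⇒a≡b (toℕ<n u) (toℕ<n v) (∣-sum (∣-sum d f refl) (∣m⇒∣-m e) (lemma (toℤ u) U V (toℤ v))))
      where lemma : ∀ x y z w → ((x - y) + (y - z)) + - (w - z) ≡ x - w
            lemma = solve-∀

    mod-≅ : ∀ k → k mod p ≅ + k
    mod-≅ k = mk≅ (subst (+ p ∣_) (sym eq) (∣m⇒∣-m (∣n⇒∣m*n (+ (k / p)) ∣-refl)))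
      where
      eq : toℤ (k mod p) - + k ≡ - (+ (k / p) * + p)
      eq = begin
        toℤ (k mod p) - + k                        ≡⟨ cong₂ (λ r k → + r - k) (toℕ-fromℕ< _) (a≡a%ℕn+[a/ℕn]*n (+ k) p) ⟩
        + (k % p) - (+ (k % p) + + (k / p) * + p)  ≡⟨ lemma (+ (k % p)) (+ (k / p)) (+ p) ⟩
        - (+ (k / p) * + p)                        ∎
        where
        open ≡-Reasoning
        lemma : ∀ r q d → r - (r + q * d) ≡ - (q * d)
        lemma = solve-∀

    +ₚ-≅ : ∀ {u v U V} → u ≅ U → v ≅ V → u +ₚ v ≅ U + V
    +ₚ-≅ {u} {v} {U} {V} (mk≅ d) (mk≅ e) = ≅-trans-∣ (mod-≅ (toℕ u ℕ.+ toℕ v)) (∣-sum d e eq)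
      where
      eq : (toℤ u - U) + (toℤ v - V) ≡ + (toℕ u ℕ.+ toℕ v) - (U + V)
      eq = trans (lemma (toℤ u) (toℤ v) U V) (cong (_- (U + V)) (sym (pos-+ (toℕ u) (toℕ v))))
        where lemma : ∀ x y X Y → (x - X) + (y - Y) ≡ (x + y) - (X + Y)
              lemma = solve-∀

    *ₚ-≅ : ∀ {u v U V} → u ≅ U → v ≅ V → u *ₚ v ≅ U * V
    *ₚ-≅ {u} {v} {U} {V} (mk≅ d) (mk≅ e) =
      ≅-trans-∣ (mod-≅ (toℕ u ℕ.* toℕ v)) (∣-sum (∣n⇒∣m*n (toℤ u) e) (∣n⇒∣m*n V d) eq)
      where
      eq : toℤ u * (toℤ v - V) + V * (toℤ u - U) ≡ + (toℕ u ℕ.* toℕ v) - U * V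
      eq = trans (lemma (toℤ u) (toℤ v) U V) (cong (_- U * V) (sym (pos-* (toℕ u) (toℕ v))))
        where lemma : ∀ x y X Y → x * (y - Y) + Y * (x - X) ≡ x * y - X * Y
              lemma = solve-∀

    negₚ-≅ : ∀ {v V} → v ≅ V → -ₚ v ≅ - V
    negₚ-≅ {v} {V} (mk≅ e) = ≅-trans-∣ (mod-≅ (p ℕ.∸ toℕ v)) (∣-sum ∣-refl (∣m⇒∣-m e) eq)
      where
      eq : + p + - (toℤ v - V) ≡ + (p ℕ.∸ toℕ v) - - V
      eq = begin
        + p + - (toℤ v - V)    ≡⟨ lemma (+ p) (toℤ v) V ⟩
        (+ p - toℤ v) - - V    ≡⟨ cong (_- - V) (trans (m-n≡m⊖n p (toℕ v)) (⊖-≥ (ℕ.<⇒≤ (toℕ<n v)))) ⟩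
        + (p ℕ.∸ toℕ v) - - V  ∎
        where
        open ≡-Reasoning
        lemma : ∀ q x X → q + - (x - X) ≡ (q - x) - - X
        lemma = solve-∀

    -ₚ-≅ : ∀ {u v U V} → u ≅ U → v ≅ V → u -ₚ v ≅ U - V
    -ₚ-≅ u≅U v≅V = +ₚ-≅ u≅U (negₚ-≅ v≅V)

    infixl 7 _×ₚ_
    _×ₚ_ : ℕ → Fin p → Fin p
    zero  ×ₚ a = 0 mod p
    suc k ×ₚ a = k ×ₚ a +ₚ a

    ×ₚ-≅ : ∀ k a → k ×ₚ a ≅ + k * toℤ a
    ×ₚ-≅ zero    a = ≅-trans-∣ (mod-≅ 0) (subst (+ p ∣_) (lemma (toℤ a)) p∣0)
      where lemma : ∀ x → + 0 ≡ + 0 - + 0 * x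
            lemma = solve-∀
    ×ₚ-≅ (suc k) a = ≅-trans-∣ (+ₚ-≅ (×ₚ-≅ k a) (toℤ-≅ a)) (subst (+ p ∣_) eq p∣0)
      where
      eq : + 0 ≡ + k * toℤ a + toℤ a - + suc k * toℤ a
      eq = trans (lemma (+ k) (toℤ a)) (cong (λ s → + k * toℤ a + toℤ a - s * toℤ a) (sym (pos-+ 1 k)))
        where lemma : ∀ k x → + 0 ≡ k * x + x - (+ 1 + k) * x
              lemma = solve-∀

    ∣toℤ⇒≡0 : ∀ {a} → + p ∣ toℤ a → toℕ a ≡ 0
    ∣toℤ⇒≡0 {a} p∣a = ∣∧<⇒≡0 (∣⇒∣ᵤ p∣a) (toℕ<n a)

    ≢⇒∤- : ∀ {u v} → u ≢ v → ¬ (+ p ∣ toℤ u - toℤ v)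
    ≢⇒∤- {u} {v} u≢v p∣u-v = u≢v (∣⇒≅-≡ (toℤ-≅ u) (toℤ-≅ v) p∣u-v)

    module _ (p-prime : Prime p) where

      ×ₚ-injective : ∀ {a k k′} → toℕ a ≢ 0 → k ℕ.< p → k′ ℕ.< p → k ×ₚ a ≡ k′ ×ₚ a → k ≡ k′
      ×ₚ-injective {a} {k} {k′} a≢0 k<p k′<p eq =
        p∣a-b⇒a≡b k<p k′<p (prime-∣*⇒∣ p-prime (a≢0 ∘ ∣toℤ⇒≡0) p∣a[k-k′])
        where
        p∣a[k-k′] : + p ∣ toℤ a * (+ k - + k′)
        p∣a[k-k′] = subst (+ p ∣_) (lemma (+ k) (+ k′) (toℤ a)) (≅-≡⇒∣ (×ₚ-≅ k a) (×ₚ-≅ k′ a) eq)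
          where lemma : ∀ k k′ x → k * x - k′ * x ≡ x * (k - k′)
                lemma = solve-∀

      *ₚ-cancelʳ-≢ : ∀ {u v y y′} → y ≢ y′ → u *ₚ (y -ₚ y′) ≡ v *ₚ (y -ₚ y′) → u ≡ v
      *ₚ-cancelʳ-≢ {u} {v} {y} {y′} y≢y′ eq =
        ∣⇒≅-≡ (toℤ-≅ u) (toℤ-≅ v) (prime-∣*⇒∣ p-prime (≢⇒∤- y≢y′) p∣d[u-v])
        where
        d≅ : y -ₚ y′ ≅ toℤ y - toℤ y′
        d≅ = -ₚ-≅ (toℤ-≅ y) (toℤ-≅ y′)
        p∣d[u-v] : + p ∣ (toℤ y - toℤ y′) * (toℤ u - toℤ v)
        p∣d[u-v] = subst (+ p ∣_) (lemma (toℤ u) (toℤ v) (toℤ y - toℤ y′))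
                                  (≅-≡⇒∣ (*ₚ-≅ (toℤ-≅ u) d≅) (*ₚ-≅ (toℤ-≅ v) d≅) eq)
          where lemma : ∀ u v d → u * d - v * d ≡ d * (u - v)
                lemma = solve-∀

module SumsetCopies where

  open Residues
  open import Defs
  open import Data.Fin.Base using (Fin)
  open import Data.Fin.Properties using (_≟_; any?)
  open import Data.Fin.Subset using (Subset; _∈_)
  open import Data.Fin.Subset.Properties using (_∈?_)
  open import Data.Integer.Base using (ℤ; +_; _+_; _-_; _*_)
  open import Data.Integer.Divisibility.Signed using (_∣_; ∣n⇒∣m*n)
  open import Data.Integer.Tactic.RingSolver using (solve-∀)
  open import Data.Nat.Base using (ℕ; NonZero)
  open import Data.Nat.DivMod using (_mod_)
  open import Data.Nat.Primality using (Prime)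
  open import Data.Product.Base using (∃-syntax; _×_; _,_)
  open import Data.Sum.Base using (_⊎_; inj₁; inj₂)
  open import Relation.Binary.PropositionalEquality
  open import Relation.Nullary.Decidable.Core using (Dec; yes; no; ¬?; _×-dec_; map′)

  module _ {p : ℕ} .{{_ : NonZero p}} where

    ⊕-intro : ∀ {S T : ZSet} {s t} → S s → T t → (S ⊕ T) (s +ₚ t)
    ⊕-intro s∈S t∈T = _ , _ , s∈S , t∈T , refl

    ⊖-intro : ∀ {S T : ZSet} {s t} → S s → T t → (S ⊖ T) (s -ₚ t)
    ⊖-intro s∈S t∈T = _ , _ , s∈S , t∈T , refl

    ⊗-intro : ∀ {S T : ZSet} {s t} → S s → T t → (S ⊗ T) (s *ₚ t)
    ⊗-intro s∈S t∈T = _ , _ , s∈S , t∈T , refl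

    ⊛-intro : ∀ a {S : ZSet} {s} → S s → (a ⊛ S) (a *ₚ s)
    ⊛-intro _ s∈S = _ , s∈S , refl

    LineCollision : Fin p → Fin p × Fin p → Fin p × Fin p → Set
    LineCollision ξ (x , y) (x′ , y′) = y ≢ y′ × x′ -ₚ x ≡ ξ *ₚ (y -ₚ y′)

    LineCollision? : ∀ ξ u v → Dec (LineCollision ξ u v)
    LineCollision? ξ (x , y) (x′ , y′) = ¬? (y ≟ y′) ×-dec (x′ -ₚ x ≟ ξ *ₚ (y -ₚ y′))

    LineCollision-unique : Prime p → ∀ {ξ ξ′ u v} → LineCollision ξ u v → LineCollision ξ′ u v → ξ ≡ ξ′
    LineCollision-unique p-prime (y≢y′ , eq) (_ , eq′) = *ₚ-cancelʳ-≢ p-prime y≢y′ (trans (sym eq) eq′)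

    LineCollision-0 : ∀ {x y y′} → y ≢ y′ → LineCollision (0 mod p) (x , y) (x , y′)
    LineCollision-0 {x} {y} {y′} y≢y′ =
      y≢y′ , ∣⇒≅-≡ (-ₚ-≅ (toℤ-≅ x) (toℤ-≅ x)) (*ₚ-≅ (mod-≅ 0) (-ₚ-≅ (toℤ-≅ y) (toℤ-≅ y′)))
                   (subst (+ p ∣_) (lemma (toℤ x) (toℤ y - toℤ y′)) p∣0)
      where lemma : ∀ x d → + 0 ≡ (x - x) - + 0 * d
            lemma = solve-∀

    line-collision : ∀ {ξ Ξ x y x′ y′} → ξ ≅ Ξ → + p ∣ (toℤ x′ + Ξ * toℤ y′) - (toℤ x + Ξ * toℤ y) →
                     (x , y) ≡ (x′ , y′) ⊎ LineCollision ξ (x , y) (x′ , y′)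
    line-collision {ξ} {Ξ} {x} {y} {x′} {y′} ξ≅Ξ p∣l′-l with y ≟ y′
    ... | yes refl = inj₁ (cong (_, y) (sym (∣⇒≅-≡ (toℤ-≅ x′) (toℤ-≅ x) p∣x′-x)))
      where
      p∣x′-x : + p ∣ toℤ x′ - toℤ x
      p∣x′-x = subst (+ p ∣_) (lemma (toℤ x) (toℤ x′) (Ξ * toℤ y)) p∣l′-l
        where lemma : ∀ x x′ z → (x′ + z) - (x + z) ≡ x′ - x
              lemma = solve-∀
    ... | no y≢y′  = inj₂ (y≢y′ , ∣⇒≅-≡ (-ₚ-≅ (toℤ-≅ x′) (toℤ-≅ x)) (*ₚ-≅ ξ≅Ξ (-ₚ-≅ (toℤ-≅ y) (toℤ-≅ y′))) p∣rel)
      where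
      p∣rel : + p ∣ (toℤ x′ - toℤ x) - Ξ * (toℤ y - toℤ y′)
      p∣rel = subst (+ p ∣_) (lemma (toℤ x) (toℤ y) (toℤ x′) (toℤ y′) Ξ) p∣l′-l
        where lemma : ∀ x y x′ y′ c → (x′ + c * y′) - (x + c * y) ≡ (x′ - x) - c * (y - y′)
              lemma = solve-∀

    module _ (X Y : Subset p) where

      InXY : Fin p × Fin p → Set
      InXY (x , y) = x ∈ X × y ∈ Y

      InXY? : ∀ u → Dec (InXY u)
      InXY? (x , y) = x ∈? X ×-dec y ∈? Y

      DifferenceRatio : Fin p → Set
      DifferenceRatio ξ = ∃[ u ] ∃[ v ] (InXY u × InXY v × LineCollision ξ u v)

      DifferenceRatio? : ∀ ξ → Dec (DifferenceRatio ξ)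
      DifferenceRatio? ξ = ∃₂? λ u → ∃₂? λ v → InXY? u ×-dec InXY? v ×-dec LineCollision? ξ u v
        where
        ∃₂? : ∀ {P : Fin p × Fin p → Set} → (∀ u → Dec (P u)) → Dec (∃[ u ] P u)
        ∃₂? P? = map′ (λ (x , y , Pxy) → (x , y) , Pxy) (λ ((x , y) , Pxy) → x , y , Pxy)
                      (any? λ x → any? λ y → P? (x , y))

      record SumsetCopy (a ξ : Fin p) : Set where
        field
          embed           : Fin p × Fin p → Fin p
          embed-∈         : ∀ {u} → InXY u → bigSet X Y a (embed u)
          embed-collision : ∀ {u v} → InXY u → InXY v → embed v ≡ embed u → u ≡ v ⊎ LineCollision ξ u v

      module Embedding (p-prime : Prime p) (a ξ : Fin p) {x₁ x₂ y₁ y₂ : Fin p}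
                       (x₁∈X : x₁ ∈ X) (x₂∈X : x₂ ∈ X) (y₁∈Y : y₁ ∈ Y) (y₂∈Y : y₂ ∈ Y)
                       (y₁≢y₂ : y₁ ≢ y₂) (rel : x₁ -ₚ x₂ ≡ ξ *ₚ (y₁ -ₚ y₂)) where

        -- Written in the shape of an element of bigSet; by rel it equals (y₁ - y₂) (x + ξ y + a w).
        F : Fin p → Fin p × Fin p → Fin p
        F w (x , y) = x *ₚ y₁ +ₚ x₁ *ₚ y -ₚ (x *ₚ y₂ +ₚ x₂ *ₚ y) +ₚ a *ₚ (w *ₚ y₁) -ₚ a *ₚ (w *ₚ y₂)

        F-∈ : ∀ {w x y} → w ∈ Y → x ∈ X → y ∈ Y → bigSet X Y a (F w (x , y))
        F-∈ w∈Y x∈X y∈Y =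
          ⊖-intro (⊕-intro (⊖-intro (⊕-intro (⊗-intro x∈X y₁∈Y) (⊗-intro x₁∈X y∈Y))
                                    (⊕-intro (⊗-intro x∈X y₂∈Y) (⊗-intro x₂∈X y∈Y)))
                           (⊛-intro a (⊗-intro w∈Y y₁∈Y)))
                  (⊛-intro a (⊗-intro w∈Y y₂∈Y))

        linear : Fin p → Fin p × Fin p → ℤ
        linear w (x , y) = toℤ x + toℤ ξ * toℤ y + toℤ a * toℤ w

        F-≅ : ∀ w u → F w u ≅ (toℤ y₁ - toℤ y₂) * linear w u
        F-≅ w (x , y) = ≅-trans-∣ expand (subst (+ p ∣_) (lemma x̂ ŷ ŵ x̂₁ x̂₂ ŷ₁ ŷ₂ ξ̂ â) (∣n⇒∣m*n ŷ rel-ℤ))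
          where
          x̂ ŷ ŵ x̂₁ x̂₂ ŷ₁ ŷ₂ ξ̂ â : ℤ
          x̂ = toℤ x ; ŷ = toℤ y ; ŵ = toℤ w ; x̂₁ = toℤ x₁ ; x̂₂ = toℤ x₂
          ŷ₁ = toℤ y₁ ; ŷ₂ = toℤ y₂ ; ξ̂ = toℤ ξ ; â = toℤ a
          ⟨_⟩ : ∀ u → u ≅ toℤ u
          ⟨_⟩ = toℤ-≅
          expand : F w (x , y) ≅ x̂ * ŷ₁ + x̂₁ * ŷ - (x̂ * ŷ₂ + x̂₂ * ŷ) + â * (ŵ * ŷ₁) - â * (ŵ * ŷ₂)
          expand = -ₚ-≅ (+ₚ-≅ (-ₚ-≅ (+ₚ-≅ (*ₚ-≅ ⟨ x ⟩ ⟨ y₁ ⟩) (*ₚ-≅ ⟨ x₁ ⟩ ⟨ y ⟩))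
                                    (+ₚ-≅ (*ₚ-≅ ⟨ x ⟩ ⟨ y₂ ⟩) (*ₚ-≅ ⟨ x₂ ⟩ ⟨ y ⟩)))
                              (*ₚ-≅ ⟨ a ⟩ (*ₚ-≅ ⟨ w ⟩ ⟨ y₁ ⟩)))
                        (*ₚ-≅ ⟨ a ⟩ (*ₚ-≅ ⟨ w ⟩ ⟨ y₂ ⟩))
          rel-ℤ : + p ∣ (x̂₁ - x̂₂) - ξ̂ * (ŷ₁ - ŷ₂)
          rel-ℤ = ≅-≡⇒∣ (-ₚ-≅ ⟨ x₁ ⟩ ⟨ x₂ ⟩) (*ₚ-≅ ⟨ ξ ⟩ (-ₚ-≅ ⟨ y₁ ⟩ ⟨ y₂ ⟩)) rel
          lemma : ∀ x y w x₁ x₂ y₁ y₂ ξ a →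
                  y * ((x₁ - x₂) - ξ * (y₁ - y₂)) ≡
                  (x * y₁ + x₁ * y - (x * y₂ + x₂ * y) + a * (w * y₁) - a * (w * y₂))
                    - (y₁ - y₂) * (x + ξ * y + a * w)
          lemma = solve-∀

        F-collision : ∀ {w w′ u u′} → F w′ u′ ≡ F w u → + p ∣ linear w′ u′ - linear w u
        F-collision {w} {w′} {u} {u′} eq = prime-∣*⇒∣ p-prime (≢⇒∤- y₁≢y₂) p∣d[l′-l]
          where
          p∣d[l′-l] : + p ∣ (toℤ y₁ - toℤ y₂) * (linear w′ u′ - linear w u)
          p∣d[l′-l] = subst (+ p ∣_) (lemma (toℤ y₁ - toℤ y₂) (linear w′ u′) (linear w u))
                                     (≅-≡⇒∣ (F-≅ w′ u′) (F-≅ w u) eq)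
            where lemma : ∀ d l′ l → d * l′ - d * l ≡ d * (l′ - l)
                  lemma = solve-∀

        copy : SumsetCopy a ξ
        copy = record
          { embed           = F y₁
          ; embed-∈         = λ (x∈X , y∈Y) → F-∈ y₁∈Y x∈X y∈Y
          ; embed-collision = λ {(x , y)} {(x′ , y′)} _ _ eq → line-collision (toℤ-≅ ξ)
              (subst (+ p ∣_) (lemma (toℤ x) (toℤ y) (toℤ x′) (toℤ y′) (toℤ ξ) (toℤ a * toℤ y₁)) (F-collision eq))
          }
          where lemma : ∀ x y x′ y′ ξ c → (x′ + ξ * y′ + c) - (x + ξ * y + c) ≡ (x′ + ξ * y′) - (x + ξ * y)
                lemma = solve-∀

        shifted-copy : SumsetCopy a (ξ +ₚ a)
        shifted-copy = record
          { embed           = λ (x , y) → F y (x , y)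
          ; embed-∈         = λ (x∈X , y∈Y) → F-∈ y∈Y x∈X y∈Y
          ; embed-collision = λ {(x , y)} {(x′ , y′)} _ _ eq → line-collision (+ₚ-≅ (toℤ-≅ ξ) (toℤ-≅ a))
              (subst (+ p ∣_) (lemma (toℤ x) (toℤ y) (toℤ x′) (toℤ y′) (toℤ ξ) (toℤ a)) (F-collision eq))
          }
          where lemma : ∀ x y x′ y′ ξ a →
                        (x′ + ξ * y′ + a * y′) - (x + ξ * y + a * y) ≡ (x′ + (ξ + a) * y′) - (x + (ξ + a) * y)
                lemma = solve-∀

      sumset-copies : Prime p → ∀ a {ξ} → DifferenceRatio ξ → SumsetCopy a ξ × SumsetCopy a (ξ +ₚ a)
      sumset-copies p-prime a {ξ} ((x₂ , y₁) , (x₁ , y₂) , (x₂∈X , y₁∈Y) , (x₁∈X , y₂∈Y) , y₁≢y₂ , rel) =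
        copy , shifted-copy
        where open Embedding p-prime a ξ x₁∈X x₂∈X y₁∈Y y₂∈Y y₁≢y₂ rel

open Counting
open Residues using (_×ₚ_; ×ₚ-injective)
open SumsetCopies
open import Defs using (bigSet; _+ₚ_)
open import Data.Nat.Base
  using (ℕ; zero; suc; _+_; _*_; _∸_; _≤_; _<_; z≤n; s≤s; s≤s⁻¹; NonZero; >-nonZero; >-nonZero⁻¹)
open import Data.Nat.Properties hiding (_≟_)
open import Algebra.Properties.Semiring.Sum +-*-semiring using (sum; sum-cong-≗; ∑-distrib-+; *-distribˡ-sum)
open import Data.Nat.Tactic.RingSolver using (solve-∀)
open import Data.Nat.Primality using (Prime)
open import Data.Fin.Base using (Fin; toℕ)
open import Data.Fin.Properties using (_≟_; any?; toℕ<n; toℕ-injective)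
open import Data.Fin.Subset using (Subset; _∈_; _⊆_; ∣_∣; ⁅_⁆)
open import Data.Fin.Subset.Properties
  using (_∈?_; nonempty?; Empty-unique; ∣⊥∣≡0; ∣⁅x⁆∣≡1; p⊆q⇒∣p∣≤∣q∣; x∈⁅x⁆; x∈⁅y⁆⇒x≡y)
open import Data.Product.Base using (∃-syntax; _×_; _,_; proj₁; proj₂)
open import Data.Sum.Base using (_⊎_; inj₁; inj₂; [_,_])
open import Function.Base using (_∘_)
open import Function.Bundles using (_⇔_; Equivalence)
open import Relation.Binary.PropositionalEquality
  using (_≡_; _≢_; refl; sym; trans; cong; cong₂; subst; subst₂; module ≡-Reasoning)
open import Relation.Nullary.Decidable.Core using (Dec; yes; no; ¬?; _×-dec_; decidable-stable)
open import Relation.Nullary.Negation.Core using (¬_; contradiction)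

first-failure : ∀ {ℓ} {P : ℕ → Set ℓ} → (∀ k → Dec (P k)) → P 0 →
                ∀ n → (∀ k → k ≤ n → P k) ⊎ ∃[ k ] (P k × ¬ P (suc k))
first-failure {P = P} P? P0 zero = inj₁ λ k k≤0 → subst P (sym (n≤0⇒n≡0 k≤0)) P0
first-failure {P = P} P? P0 (suc n) with first-failure P? P0 n
... | inj₂ failure = inj₂ failure
... | inj₁ P≤n with P? (suc n)
...   | no ¬P1+n = inj₂ (n , P≤n n ≤-refl , ¬P1+n)
...   | yes P1+n = inj₁ P≤1+n
  where
  P≤1+n : ∀ k → k ≤ suc n → P k
  P≤1+n k k≤1+n with m≤n⇒m<n∨m≡n k≤1+n
  ... | inj₁ k<1+n = P≤n k (s≤s⁻¹ k<1+n)
  ... | inj₂ refl  = P1+n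

∈⇒1≤∣∣ : ∀ {n x} {S : Subset n} → x ∈ S → 1 ≤ ∣ S ∣
∈⇒1≤∣∣ {x = x} {S} x∈S = subst (_≤ ∣ S ∣) (∣⁅x⁆∣≡1 x) (p⊆q⇒∣p∣≤∣q∣ ⁅x⁆⊆S)
  where
  ⁅x⁆⊆S : ⁅ x ⁆ ⊆ S
  ⁅x⁆⊆S y∈⁅x⁆ = subst (_∈ S) (sym (x∈⁅y⁆⇒x≡y x y∈⁅x⁆)) x∈S

two-distinct : ∀ {n} {Y : Subset n} → 1 < ∣ Y ∣ → ∃[ y₁ ] ∃[ y₂ ] (y₁ ∈ Y × y₂ ∈ Y × y₁ ≢ y₂)
two-distinct {n} {Y} 1<∣Y∣ with nonempty? Y
... | no Y-empty = contradiction (subst (1 <_) (trans (cong ∣_∣ (Empty-unique Y-empty)) (∣⊥∣≡0 n)) 1<∣Y∣) λ ()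
... | yes (y₁ , y₁∈Y) with any? (λ y → y ∈? Y ×-dec ¬? (y₁ ≟ y))
...   | yes (y₂ , y₂∈Y , y₁≢y₂) = y₁ , y₂ , y₁∈Y , y₂∈Y , y₁≢y₂
...   | no none = contradiction (subst (∣ Y ∣ ≤_) (∣⁅x⁆∣≡1 y₁) (p⊆q⇒∣p∣≤∣q∣ Y⊆⁅y₁⁆)) (<⇒≱ 1<∣Y∣)
  where
  Y⊆⁅y₁⁆ : Y ⊆ ⁅ y₁ ⁆
  Y⊆⁅y₁⁆ {y} y∈Y = subst (_∈ ⁅ y₁ ⁆) (decidable-stable (y₁ ≟ y) λ y₁≢y → none (y , y∈Y , y₁≢y)) (x∈⁅x⁆ y₁)

module Estimate {p : ℕ} .{{_ : NonZero p}} (p-prime : Prime p) (X Y S : Subset p)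
                (a : Fin p) (a≢0 : toℕ a ≢ 0) (bigSet⊆S : ∀ {z} → bigSet X Y a z → z ∈ S) where

  open PairCounting (InXY? X Y)

  K : ℕ
  K = p ∸ 1

  collisions : Fin p → ℕ
  collisions ξ = pairCount (LineCollision? ξ)

  size≡∣X∣*∣Y∣ : size ≡ ∣ X ∣ * ∣ Y ∣
  size≡∣X∣*∣Y∣ = begin
    sum (λ x → sum λ y → 𝟙 (x ∈? X ×-dec y ∈? Y))    ≡⟨ sum-cong-≗ (λ x → sum-cong-≗ λ y → 𝟙-×-dec (x ∈? X) (y ∈? Y)) ⟩
    sum (λ x → sum λ y → 𝟙 (x ∈? X) * 𝟙 (y ∈? Y))    ≡⟨ sum-*-sum (λ x → 𝟙 (x ∈? X)) (λ y → 𝟙 (y ∈? Y)) ⟨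
    sum (λ x → 𝟙 (x ∈? X)) * sum (λ y → 𝟙 (y ∈? Y))  ≡⟨ cong₂ _*_ (∣S∣≡sum𝟙∈ X) (∣S∣≡sum𝟙∈ Y) ⟨
    ∣ X ∣ * ∣ Y ∣                                    ∎
    where open ≡-Reasoning

  copy-bound : ∀ {ξ} → SumsetCopy X Y a ξ → size * size ≤ ∣ S ∣ * (size + collisions ξ)
  copy-bound {ξ} copy = ≤-trans (size²≤∣S∣*energy embed S (bigSet⊆S ∘ embed-∈))
                                (*-monoʳ-≤ ∣ S ∣ (energy≤size+pairCount embed (LineCollision? ξ) embed-collision))
    where open SumsetCopy copy

  module _ (0<size : 0 < size) where

    instance
      _ : NonZero size
      _ = >-nonZero 0<size

    gap-bound : ∀ {ξ} → DifferenceRatio X Y ξ → ¬ DifferenceRatio X Y (ξ +ₚ a) →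
                size * K ≤ ∣ S ∣ * (size + K)
    gap-bound {ξ} r ¬r = ≤-trans (*-monoˡ-≤ K size≤∣S∣) (*-monoʳ-≤ ∣ S ∣ (m≤n+m K size))
      where
      collisions≡0 : collisions (ξ +ₚ a) ≡ 0
      collisions≡0 = pairCount≡0 (LineCollision? (ξ +ₚ a)) λ {u} {v} u∈XY v∈XY c → ¬r (u , v , u∈XY , v∈XY , c)
      size≤∣S∣ : size ≤ ∣ S ∣
      size≤∣S∣ = *-cancelʳ-≤ size ∣ S ∣ size (begin
        size * size                           ≤⟨ copy-bound (proj₂ (sumset-copies X Y p-prime a r)) ⟩
        ∣ S ∣ * (size + collisions (ξ +ₚ a))  ≡⟨ cong (λ c → ∣ S ∣ * (size + c)) collisions≡0 ⟩
        ∣ S ∣ * (size + 0)                    ≡⟨ cong (∣ S ∣ *_) (+-identityʳ size) ⟩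
        ∣ S ∣ * size                          ∎)
        where open ≤-Reasoning

    saturated-bound : (∀ k → k ≤ K → DifferenceRatio X Y (k ×ₚ a)) → size * K ≤ ∣ S ∣ * (size + K)
    saturated-bound saturated = *-cancelˡ-≤ size (subst₂ _≤_ (lemma₁ size K) (lemma₂ size K ∣ S ∣) (begin
      K * (size * size)
        ≡⟨ sum-const K (size * size) ⟨
      sum {K} (λ _ → size * size)
        ≤⟨ sum-mono-≤ (λ i → copy-bound (proj₁ (sumset-copies X Y p-prime a {ξ i} (saturated _ (toℕ<n i))))) ⟩
      sum (λ i → ∣ S ∣ * (size + collisions (ξ i)))
        ≡⟨ *-distribˡ-sum ∣ S ∣ (λ i → size + collisions (ξ i)) ⟨
      ∣ S ∣ * sum (λ i → size + collisions (ξ i))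
        ≡⟨ cong (∣ S ∣ *_) (∑-distrib-+ {K} (λ _ → size) (λ i → collisions (ξ i))) ⟩
      ∣ S ∣ * (sum {K} (λ _ → size) + sum (λ i → collisions (ξ i)))
        ≤⟨ *-monoʳ-≤ ∣ S ∣ (+-mono-≤ (≤-reflexive (sum-const K size)) ∑collisions≤size²) ⟩
      ∣ S ∣ * (K * size + size * size) ∎))
      where
      open ≤-Reasoning
      ξ : Fin K → Fin p
      ξ i = suc (toℕ i) ×ₚ a
      1+i<p : ∀ (i : Fin K) → suc (toℕ i) < p
      1+i<p i = subst (suc (toℕ i) <_) (m+[n∸m]≡n (>-nonZero⁻¹ p)) (s≤s (toℕ<n i))
      ξ-unique : ∀ {i j u v} → LineCollision (ξ i) u v → LineCollision (ξ j) u v → i ≡ j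
      ξ-unique {i} {j} {u} {v} cᵢ cⱼ = toℕ-injective (suc-injective
        (×ₚ-injective p-prime a≢0 (1+i<p i) (1+i<p j) (LineCollision-unique p-prime {ξ i} {ξ j} {u} {v} cᵢ cⱼ)))
      ∑collisions≤size² : sum (λ i → collisions (ξ i)) ≤ size * size
      ∑collisions≤size² = sum-pairCount≤size² (λ i → LineCollision? (ξ i)) λ {i} {j} {u} {v} → ξ-unique {i} {j} {u} {v}
      lemma₁ : ∀ N K → K * (N * N) ≡ N * (N * K)
      lemma₁ = solve-∀
      lemma₂ : ∀ N K s → s * (K * N + N * N) ≡ N * (s * (N + K))
      lemma₂ = solve-∀

  bound : ∀ {x₀ y₁ y₂} → x₀ ∈ X → y₁ ∈ Y → y₂ ∈ Y → y₁ ≢ y₂ → size * K ≤ ∣ S ∣ * (size + K)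
  bound {x₀} {y₁} {y₂} x₀∈X y₁∈Y y₂∈Y y₁≢y₂ =
    [ saturated-bound 0<size , (λ (_ , r , ¬r) → gap-bound 0<size r ¬r) ]
      (first-failure (λ k → DifferenceRatio? X Y (k ×ₚ a)) ratio-0 K)
    where
    ratio-0 : DifferenceRatio X Y (0 ×ₚ a)
    ratio-0 = (x₀ , y₁) , (x₀ , y₂) , (x₀∈X , y₁∈Y) , (x₀∈X , y₂∈Y) , LineCollision-0 y₁≢y₂
    0<size : 0 < size
    0<size = subst (0 <_) (sym size≡∣X∣*∣Y∣) (*-mono-≤ (∈⇒1≤∣∣ x₀∈X) (∈⇒1≤∣∣ y₁∈Y))

corollary3 : (p : ℕ) → {{_ : NonZero p}} → Prime p → 2 < p →
    (X Y : Subset p) → 1 < ∣ Y ∣ →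
    (a : Fin p) → toℕ a ≢ 0 →
    (S : Subset p) → (∀ z → (z ∈ S) ⇔ bigSet X Y a z) →
    ∣ X ∣ * ∣ Y ∣ * (p ∸ 1) ≤ ∣ S ∣ * (∣ X ∣ * ∣ Y ∣ + (p ∸ 1))
-- The argument works for every prime p.
corollary3 p p-prime _ X Y 1<∣Y∣ a a≢0 S S⇔bigSet with nonempty? X | two-distinct 1<∣Y∣
... | no X-empty | _ = subst (λ m → m * ∣ Y ∣ * (p ∸ 1) ≤ ∣ S ∣ * (m * ∣ Y ∣ + (p ∸ 1))) (sym ∣X∣≡0) z≤n
  where
  ∣X∣≡0 : ∣ X ∣ ≡ 0
  ∣X∣≡0 = trans (cong ∣_∣ (Empty-unique X-empty)) (∣⊥∣≡0 p)
... | yes (x₀ , x₀∈X) | (y₁ , y₂ , y₁∈Y , y₂∈Y , y₁≢y₂) =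
  subst (λ N → N * (p ∸ 1) ≤ ∣ S ∣ * (N + (p ∸ 1))) size≡∣X∣*∣Y∣ (bound x₀∈X y₁∈Y y₂∈Y y₁≢y₂)
  where open Estimate p-prime X Y S a a≢0 (Equivalence.from (S⇔bigSet _))
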